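{- For every natural number $n$ and every positive natural number $m$, \[ \sum_{i=0}^{m-1} \left\lfloor \frac{n+i}{2m} \right\rfloor \;=\; \frac{n}{2} - m \cdot \mathrm{Zigzag}\!\left(\frac{n}{2m}\right). \]
   Context: For a real number $x$, $\mathrm{Zigzag}(x) = \min\left(x - \lfloor x \rfloor,\ \lceil x \rceil - x\right)$. -}

module Defs where

open import Data.Nat using (ℕ; zero; suc)
open import Data.Integer using (ℤ; +_)
import Data.Integer as ℤ
open import Data.Rational using (ℚ; _-_; _⊓_; _/_; floor; ceiling)

Zigzag : ℚ → ℚ
Zigzag x = (x - (floor x / 1)) ⊓ ((ceiling x / 1) - x)

∑< : ℕ → (ℕ → ℤ) → ℤ
∑< zero    f = + 0
∑< (suc m) f = ∑< m f ℤ.+ f m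

open import Data.Nat using (NonZero; _*_)
open import Data.Nat.Properties using (m*n≢0)

2*m≢0 : (m : ℕ) → .{{nz : NonZero m}} → NonZero (2 * m)
2*m≢0 m {{nz}} = m*n≢0 2 m {{_}} {{nz}}

module Submission where

-- Write n = 2m·q + r with r < 2m.  Of the m consecutive quotients ⌊(n+i)/2m⌋ all equal q except
-- the r + m ∸ 2m = max(0, r − m) last ones, which equal q + 1.  On the other side n/2m = q + r/2m,
-- so Zigzag(n/2m) = min(r, 2m − r)/2m and the right-hand side is m·q + (r − min(r, 2m − r))/2;
-- the two agree because 2·max(0, r − m) + min(r, 2m − r) = r.

open import Defs
open import Data.Nat using (ℕ; NonZero; _+_; _*_)
open import Data.Integer using (+_)
open import Data.Rational using (ℚ; _-_; _/_; floor)
import Data.Rational as ℚ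
open import Relation.Binary.PropositionalEquality using (_≡_)

open import Data.Nat as ℕ using (zero; suc; _∸_; _%_; _⊓_; _≤_; _<_)
import Data.Nat.Properties as ℕP
open import Data.Nat.DivMod
  using (m≡m%n+[m/n]*n; m%n<n; +-distrib-/-∣ʳ; m*n/n≡m; m<n⇒m/n≡0; m/n≡1+[m∸n]/n;
         m*n/o*n≡m/o; m%n*o≡m*o%[n*o]; m/n*n≡m)
open import Data.Nat.Divisibility using (n∣m*n)
open import Data.Nat.GCD using (gcd; gcd[m,n]∣m; gcd[m,n]∣n; gcd[m,n]≢0; n/gcd[m,n]≢0)
open import Data.Nat.Coprimality using (Coprime)
open import Data.Nat.Solver using (module +-*-Solver)
open import Data.Integer as ℤ using (ℤ)
import Data.Integer.Properties as ℤP
open import Data.Integer.DivMod using (div-pos-is-/ℕ)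
open import Data.Rational using (ceiling; 0ℚ)
open import Data.Rational.Base using (mkℚ+)
open import Data.Rational.Properties as ℚP using (toℚᵘ-injective; toℚᵘ-fromℚᵘ; /-cong)
open import Data.Rational.Unnormalised as ℚᵘ using (mkℚᵘ; *≡*; *≤*)
import Data.Rational.Unnormalised.Properties as ℚᵘP
open import Algebra.Properties.AbelianGroup ℚP.+-0-abelianGroup using (xyx⁻¹≈y; //-rightDividesʳ)
open import Data.Sum using (inj₁; inj₂)
open import Data.Product using (_,_)
open import Relation.Nullary using (yes; no; contradiction)
open import Relation.Binary.PropositionalEquality using (_≢_; refl; sym; trans; cong; cong₂; subst; module ≡-Reasoning)
open +-*-Solver using (solve; _:+_; _:*_; _:=_; con)

[n+i]/d≡n/d+[n%d+i]/d : ∀ n i d .{{_ : NonZero d}} →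
                        (n + i) ℕ./ d ≡ n ℕ./ d + (n % d + i) ℕ./ d
[n+i]/d≡n/d+[n%d+i]/d n i d = begin
  (n + i) ℕ./ d                               ≡⟨ cong (λ k → (k + i) ℕ./ d) (m≡m%n+[m/n]*n n d) ⟩
  (r + q * d + i) ℕ./ d                       ≡⟨ cong (ℕ._/ d) (solve 4 (λ r q d i → r :+ q :* d :+ i := r :+ i :+ q :* d) refl r q d i) ⟩
  (r + i + q * d) ℕ./ d                       ≡⟨ +-distrib-/-∣ʳ (r + i) (n∣m*n q) ⟩
  (r + i) ℕ./ d + q * d ℕ./ d                 ≡⟨ cong (λ k → (r + i) ℕ./ d + k) (m*n/n≡m q d) ⟩
  (r + i) ℕ./ d + q                           ≡⟨ ℕP.+-comm ((r + i) ℕ./ d) q ⟩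
  q + (r + i) ℕ./ d                           ∎
  where
  open ≡-Reasoning
  q = n ℕ./ d
  r = n % d

x∸d+x/d≡1+x∸d : ∀ x d .{{_ : NonZero d}} → x < d + d → x ∸ d + x ℕ./ d ≡ suc x ∸ d
x∸d+x/d≡1+x∸d x d x<2d with x ℕ.<? d
... | yes x<d = begin
  x ∸ d + x ℕ./ d              ≡⟨ cong₂ _+_ (ℕP.m≤n⇒m∸n≡0 (ℕP.<⇒≤ x<d)) (m<n⇒m/n≡0 x<d) ⟩
  0                            ≡⟨ ℕP.m≤n⇒m∸n≡0 x<d ⟨
  suc x ∸ d                    ∎
  where open ≡-Reasoning
... | no x≮d = begin
  x ∸ d + x ℕ./ d              ≡⟨ cong (λ k → x ∸ d + k) (m/n≡1+[m∸n]/n d≤x) ⟩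
  x ∸ d + suc ((x ∸ d) ℕ./ d)  ≡⟨ cong (λ k → x ∸ d + suc k) (m<n⇒m/n≡0 x∸d<d) ⟩
  x ∸ d + 1                    ≡⟨ ℕP.+-comm (x ∸ d) 1 ⟩
  suc (x ∸ d)                  ≡⟨ ℕP.+-∸-assoc 1 d≤x ⟨
  suc x ∸ d                    ∎
  where
  open ≡-Reasoning
  d≤x : d ≤ x
  d≤x = ℕP.≮⇒≥ x≮d
  x∸d<d : x ∸ d < d
  x∸d<d = ℕP.+-cancelʳ-< d (x ∸ d) d (subst (_< d + d) (sym (ℕP.m∸n+n≡m d≤x)) x<2d)

∑<-cong : ∀ k {f g : ℕ → ℤ} → (∀ i → f i ≡ g i) → ∑< k f ≡ ∑< k g
∑<-cong zero    f≗g = refl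
∑<-cong (suc k) f≗g = cong₂ ℤ._+_ (∑<-cong k f≗g) (f≗g k)

-- The quotients with n % d + i ≥ d are ⌊n/d⌋ + 1, the others ⌊n/d⌋.
∑<[n+i]/d : ∀ n d k .{{_ : NonZero d}} → k ≤ d →
            ∑< k (λ i → + ((n + i) ℕ./ d)) ≡ + (k * (n ℕ./ d) + (n % d + k ∸ d))
∑<[n+i]/d n d zero    _ rewrite ℕP.+-identityʳ (n % d) = cong +_ (sym (ℕP.m≤n⇒m∸n≡0 (ℕP.<⇒≤ (m%n<n n d))))
∑<[n+i]/d n d (suc k) 1+k≤d = trans
  (cong (λ s → s ℤ.+ + ((n + k) ℕ./ d)) (∑<[n+i]/d n d k (ℕP.<⇒≤ 1+k≤d)))
  (cong +_ (begin
    k * q + (r + k ∸ d) + (n + k) ℕ./ d          ≡⟨ cong (λ x → k * q + (r + k ∸ d) + x) ([n+i]/d≡n/d+[n%d+i]/d n k d) ⟩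
    k * q + (r + k ∸ d) + (q + (r + k) ℕ./ d)    ≡⟨ solve 4 (λ kq e q f → kq :+ e :+ (q :+ f) := q :+ kq :+ (e :+ f)) refl (k * q) (r + k ∸ d) q ((r + k) ℕ./ d) ⟩
    suc k * q + (r + k ∸ d + (r + k) ℕ./ d)      ≡⟨ cong (λ x → suc k * q + x) (x∸d+x/d≡1+x∸d (r + k) d (ℕP.+-mono-< (m%n<n n d) 1+k≤d)) ⟩
    suc k * q + (suc (r + k) ∸ d)                ≡⟨ cong (λ x → suc k * q + (x ∸ d)) (ℕP.+-suc r k) ⟨
    suc k * q + (r + suc k ∸ d)                  ∎))
  where
  open ≡-Reasoning
  q = n ℕ./ d
  r = n % d

-[-n/ℕd]≡n/d : ∀ n d .{{_ : NonZero d}} → n % d ≡ 0 → ℤ.- ((ℤ.- + n) ℤ./ℕ d) ≡ + (n ℕ./ d)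
-[-n/ℕd]≡n/d zero    (suc _) _ = refl
-[-n/ℕd]≡n/d (suc n) d n%d≡0 rewrite n%d≡0 = ℤP.neg-involutive _

-[-n/ℕd]≡1+n/d : ∀ n d .{{_ : NonZero d}} → n % d ≢ 0 → ℤ.- ((ℤ.- + n) ℤ./ℕ d) ≡ + suc (n ℕ./ d)
-[-n/ℕd]≡1+n/d zero    d@(suc _) 0%d≢0 = contradiction refl 0%d≢0
-[-n/ℕd]≡1+n/d (suc n) d n%d≢0 with suc n % d | n%d≢0
... | zero  | 0≢0 = contradiction refl 0≢0
... | suc _ | _   = refl

floor-mkℚ+ : ∀ n d .{{_ : NonZero d}} .(c : Coprime n d) → floor (mkℚ+ n d c) ≡ + (n ℕ./ d)
floor-mkℚ+ n (suc d) c = div-pos-is-/ℕ (+ n) (suc d)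

ceiling-mkℚ+ : ∀ n d .{{_ : NonZero d}} .(c : Coprime n d) →
               ceiling (mkℚ+ n d c) ≡ ℤ.- ((ℤ.- + n) ℤ./ℕ d)
ceiling-mkℚ+ zero    (suc d) c = refl
ceiling-mkℚ+ (suc n) (suc d) c = cong ℤ.-_ (div-pos-is-/ℕ ℤ.-[1+ n ] (suc d))

private
  /-cancel-factor : ∀ {a d} N D g .{{_ : NonZero d}} .{{_ : NonZero D}} →
                    a ≡ N * g → d ≡ D * g → a ℕ./ d ≡ N ℕ./ D
  /-cancel-factor N D g refl refl = m*n/o*n≡m/o N g D

  %-scale-factor : ∀ {a d} N D g .{{_ : NonZero d}} .{{_ : NonZero D}} →
                   a ≡ N * g → d ≡ D * g → a % d ≡ (N % D) * g
  %-scale-factor N D g refl refl = sym (m%n*o≡m*o%[n*o] N D g)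

-- floor and ceiling read off the reduced representation of a / d, so the gcd is cancelled first.
module _ (a d : ℕ) .{{_ : NonZero d}} where
  private
    g = gcd a d
    instance
      g≢0 : NonZero g
      g≢0 = ℕ.≢-nonZero (gcd[m,n]≢0 a d (inj₂ (ℕ.≢-nonZero⁻¹ d)))
      D≢0 : NonZero (d ℕ./ g)
      D≢0 = ℕ.≢-nonZero (n/gcd[m,n]≢0 a d)
    N = a ℕ./ g
    D = d ℕ./ g
    a≡N*g : a ≡ N * g
    a≡N*g = sym (m/n*n≡m (gcd[m,n]∣m a d))
    d≡D*g : d ≡ D * g
    d≡D*g = sym (m/n*n≡m (gcd[m,n]∣n a d))
    a/d≡N/D : a ℕ./ d ≡ N ℕ./ D
    a/d≡N/D = /-cancel-factor N D g a≡N*g d≡D*g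

  floor-/ : floor (+ a / d) ≡ + (a ℕ./ d)
  floor-/ = trans (floor-mkℚ+ N D _) (cong +_ (sym a/d≡N/D))

  private
    a%d≡[N%D]*g : a % d ≡ (N % D) * g
    a%d≡[N%D]*g = %-scale-factor N D g a≡N*g d≡D*g

  ceiling-/-∣ : a % d ≡ 0 → ceiling (+ a / d) ≡ + (a ℕ./ d)
  ceiling-/-∣ a%d≡0 = begin
    ceiling (+ a / d)              ≡⟨ ceiling-mkℚ+ N D _ ⟩
    ℤ.- ((ℤ.- + N) ℤ./ℕ D)         ≡⟨ -[-n/ℕd]≡n/d N D N%D≡0 ⟩
    + (N ℕ./ D)                    ≡⟨ cong +_ a/d≡N/D ⟨
    + (a ℕ./ d)                    ∎
    where
    open ≡-Reasoning
    N%D≡0 : N % D ≡ 0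
    N%D≡0 = ℕP.*-cancelʳ-≡ (N % D) 0 g (trans (sym a%d≡[N%D]*g) a%d≡0)

  ceiling-/-∤ : a % d ≢ 0 → ceiling (+ a / d) ≡ + suc (a ℕ./ d)
  ceiling-/-∤ a%d≢0 = begin
    ceiling (+ a / d)              ≡⟨ ceiling-mkℚ+ N D _ ⟩
    ℤ.- ((ℤ.- + N) ℤ./ℕ D)         ≡⟨ -[-n/ℕd]≡1+n/d N D N%D≢0 ⟩
    + suc (N ℕ./ D)                ≡⟨ cong (λ q → + suc q) a/d≡N/D ⟨
    + suc (a ℕ./ d)                ∎
    where
    open ≡-Reasoning
    N%D≢0 : N % D ≢ 0
    N%D≢0 N%D≡0 = a%d≢0 (trans a%d≡[N%D]*g (cong (_* g) N%D≡0))

fromℚᵘ-homo-+ : ∀ p q → ℚ.fromℚᵘ (p ℚᵘ.+ q) ≡ ℚ.fromℚᵘ p ℚ.+ ℚ.fromℚᵘ q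
fromℚᵘ-homo-+ p q = toℚᵘ-injective (ℚᵘP.≃-trans (toℚᵘ-fromℚᵘ (p ℚᵘ.+ q)) (ℚᵘP.≃-sym
  (ℚᵘP.≃-trans (ℚP.toℚᵘ-homo-+ (ℚ.fromℚᵘ p) (ℚ.fromℚᵘ q)) (ℚᵘP.+-cong (toℚᵘ-fromℚᵘ p) (toℚᵘ-fromℚᵘ q)))))

fromℚᵘ-homo-* : ∀ p q → ℚ.fromℚᵘ (p ℚᵘ.* q) ≡ ℚ.fromℚᵘ p ℚ.* ℚ.fromℚᵘ q
fromℚᵘ-homo-* p q = toℚᵘ-injective (ℚᵘP.≃-trans (toℚᵘ-fromℚᵘ (p ℚᵘ.* q)) (ℚᵘP.≃-sym
  (ℚᵘP.≃-trans (ℚP.toℚᵘ-homo-* (ℚ.fromℚᵘ p) (ℚ.fromℚᵘ q)) (ℚᵘP.*-cong (toℚᵘ-fromℚᵘ p) (toℚᵘ-fromℚᵘ q)))))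

/-cross : ∀ a b c d .{{_ : NonZero b}} .{{_ : NonZero d}} → a * d ≡ c * b → + a / b ≡ + c / d
/-cross a (suc b) c (suc d) ad≡cb = ℚP.fromℚᵘ-cong {mkℚᵘ (+ a) b} {mkℚᵘ (+ c) d} (*≡* (begin
  + a ℤ.* + suc d   ≡⟨ ℤP.pos-* a (suc d) ⟨
  + (a * suc d)     ≡⟨ cong +_ ad≡cb ⟩
  + (c * suc b)     ≡⟨ ℤP.pos-* c (suc b) ⟩
  + c ℤ.* + suc b   ∎))
  where open ≡-Reasoning

+-/ : ∀ a b c d .{{_ : NonZero b}} .{{_ : NonZero d}} →
      (+ a / b) ℚ.+ (+ c / d) ≡ (+ (a * d + c * b) / (b * d)) {{ℕP.m*n≢0 b d}}
+-/ a (suc b) c (suc d) = sym (trans (/-cong numerator refl) (fromℚᵘ-homo-+ (mkℚᵘ (+ a) b) (mkℚᵘ (+ c) d)))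
  where
  numerator : + (a * suc d + c * suc b) ≡ + a ℤ.* + suc d ℤ.+ + c ℤ.* + suc b
  numerator = trans (ℤP.pos-+ (a * suc d) (c * suc b)) (cong₂ ℤ._+_ (ℤP.pos-* a (suc d)) (ℤP.pos-* c (suc b)))

*-/ : ∀ a b c d .{{_ : NonZero b}} .{{_ : NonZero d}} →
      (+ a / b) ℚ.* (+ c / d) ≡ (+ (a * c) / (b * d)) {{ℕP.m*n≢0 b d}}
*-/ a (suc b) c (suc d) = sym (trans (/-cong (ℤP.pos-* a c) refl) (fromℚᵘ-homo-* (mkℚᵘ (+ a) b) (mkℚᵘ (+ c) d)))

/-monoˡ-≤ : ∀ {a c} d .{{_ : NonZero d}} → a ≤ c → + a / d ℚ.≤ + c / d
/-monoˡ-≤ {a} {c} (suc d) a≤c = ℚP.toℚᵘ-cancel-≤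
  (ℚᵘP.≤-respˡ-≃ (ℚᵘP.≃-sym (toℚᵘ-fromℚᵘ (mkℚᵘ (+ a) d)))
  (ℚᵘP.≤-respʳ-≃ (ℚᵘP.≃-sym (toℚᵘ-fromℚᵘ (mkℚᵘ (+ c) d)))
  (*≤* (ℤP.*-monoʳ-≤-nonNeg (+ suc d) (ℤ.+≤+ a≤c)))))

⊓-/ : ∀ a c d .{{_ : NonZero d}} → (+ a / d) ℚ.⊓ (+ c / d) ≡ + (a ⊓ c) / d
⊓-/ a c d with ℕP.≤-total a c
... | inj₁ a≤c = trans (ℚP.p≤q⇒p⊓q≡p (/-monoˡ-≤ d a≤c)) (cong (λ x → + x / d) (sym (ℕP.m≤n⇒m⊓n≡m a≤c)))
... | inj₂ c≤a = trans (ℚP.p≥q⇒p⊓q≡q (/-monoˡ-≤ d c≤a)) (cong (λ x → + x / d) (sym (ℕP.m≥n⇒m⊓n≡n c≤a)))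

q/1≡[q*d]/d : ∀ q d .{{_ : NonZero d}} → + q / 1 ≡ + (q * d) / d
q/1≡[q*d]/d q d = /-cross q 1 (q * d) d (sym (ℕP.*-identityʳ (q * d)))

+-/-same : ∀ a c d .{{_ : NonZero d}} → (+ a / d) ℚ.+ (+ c / d) ≡ + (a + c) / d
+-/-same a c d = trans (+-/ a d c d) (/-cross (a * d + c * d) (d * d) (a + c) d
  (solve 3 (λ a c d → (a :* d :+ c :* d) :* d := (a :+ c) :* (d :* d)) refl a c d))
  where instance _ = ℕP.m*n≢0 d d

module _ (n d : ℕ) .{{_ : NonZero d}} where
  private
    q = n ℕ./ d
    r = n % d
    x = + n / d
    open ≡-Reasoning

    n≡q*d+r : n ≡ q * d + r
    n≡q*d+r = trans (m≡m%n+[m/n]*n n d) (ℕP.+-comm r (q * d))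

    x≡q+r/d : x ≡ + q / 1 ℚ.+ + r / d
    x≡q+r/d = begin
      x                            ≡⟨ cong (λ k → + k / d) n≡q*d+r ⟩
      + (q * d + r) / d            ≡⟨ +-/-same (q * d) r d ⟨
      + (q * d) / d ℚ.+ + r / d    ≡⟨ cong (ℚ._+ + r / d) (q/1≡[q*d]/d q d) ⟨
      + q / 1 ℚ.+ + r / d          ∎

    x-⌊x⌋≡r/d : x - floor x / 1 ≡ + r / d
    x-⌊x⌋≡r/d = begin
      x - floor x / 1                  ≡⟨ cong₂ (λ y z → y - z / 1) x≡q+r/d (floor-/ n d) ⟩
      + q / 1 ℚ.+ + r / d - + q / 1    ≡⟨ xyx⁻¹≈y (+ q / 1) (+ r / d) ⟩
      + r / d                          ∎

  Zigzag-/ : Zigzag (+ n / d) ≡ + (r ⊓ (d ∸ r)) / d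
  Zigzag-/ with r ℕ.≟ 0
  ... | yes r≡0 = begin
    (x - floor x / 1) ℚ.⊓ (ceiling x / 1 - x)   ≡⟨ cong₂ ℚ._⊓_ x-⌊x⌋≡0 ⌈x⌉-x≡0 ⟩
    0ℚ                                          ≡⟨ ℚP.0/n≡0 d ⟨
    + 0 / d                                     ≡⟨ cong (λ k → + (k ⊓ (d ∸ k)) / d) r≡0 ⟨
    + (r ⊓ (d ∸ r)) / d                         ∎
    where
    r/d≡0 : + r / d ≡ 0ℚ
    r/d≡0 = trans (cong (λ k → + k / d) r≡0) (ℚP.0/n≡0 d)
    x-⌊x⌋≡0 : x - floor x / 1 ≡ 0ℚ
    x-⌊x⌋≡0 = trans x-⌊x⌋≡r/d r/d≡0
    x≡q : x ≡ + q / 1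
    x≡q = trans x≡q+r/d (trans (cong (+ q / 1 ℚ.+_) r/d≡0) (ℚP.+-identityʳ (+ q / 1)))
    ⌈x⌉-x≡0 : ceiling x / 1 - x ≡ 0ℚ
    ⌈x⌉-x≡0 = trans (cong₂ (λ y z → y / 1 - z) (ceiling-/-∣ n d r≡0) x≡q) (ℚP.+-inverseʳ (+ q / 1))
  ... | no r≢0 = begin
    (x - floor x / 1) ℚ.⊓ (ceiling x / 1 - x)   ≡⟨ cong₂ ℚ._⊓_ x-⌊x⌋≡r/d ⌈x⌉-x≡[d∸r]/d ⟩
    (+ r / d) ℚ.⊓ (+ (d ∸ r) / d)               ≡⟨ ⊓-/ r (d ∸ r) d ⟩
    + (r ⊓ (d ∸ r)) / d                         ∎
    where
    1+q≡x+[d∸r]/d : + suc q / 1 ≡ x ℚ.+ + (d ∸ r) / d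
    1+q≡x+[d∸r]/d = begin
      + suc q / 1            ≡⟨ q/1≡[q*d]/d (suc q) d ⟩
      + (suc q * d) / d      ≡⟨ cong (λ k → + k / d) [1+q]*d≡n+[d∸r] ⟩
      + (n + (d ∸ r)) / d    ≡⟨ +-/-same n (d ∸ r) d ⟨
      x ℚ.+ + (d ∸ r) / d    ∎
      where
      [1+q]*d≡n+[d∸r] : suc q * d ≡ n + (d ∸ r)
      [1+q]*d≡n+[d∸r] = begin
        d + q * d                ≡⟨ ℕP.+-comm d (q * d) ⟩
        q * d + d                ≡⟨ cong (λ k → q * d + k) (ℕP.m+[n∸m]≡n (ℕP.<⇒≤ (m%n<n n d))) ⟨
        q * d + (r + (d ∸ r))    ≡⟨ ℕP.+-assoc (q * d) r (d ∸ r) ⟨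
        q * d + r + (d ∸ r)      ≡⟨ cong (_+ (d ∸ r)) n≡q*d+r ⟨
        n + (d ∸ r)              ∎
    ⌈x⌉-x≡[d∸r]/d : ceiling x / 1 - x ≡ + (d ∸ r) / d
    ⌈x⌉-x≡[d∸r]/d = begin
      ceiling x / 1 - x          ≡⟨ cong (λ y → y / 1 - x) (ceiling-/-∤ n d r≢0) ⟩
      + suc q / 1 - x            ≡⟨ cong (_- x) 1+q≡x+[d∸r]/d ⟩
      x ℚ.+ + (d ∸ r) / d - x    ≡⟨ xyx⁻¹≈y x (+ (d ∸ r) / d) ⟩
      + (d ∸ r) / d              ∎

[r+m∸2m]+[r+m∸2m]+r⊓[2m∸r]≡r : ∀ r m → r ≤ 2 * m →
                                (r + m ∸ 2 * m) + (r + m ∸ 2 * m) + r ⊓ (2 * m ∸ r) ≡ r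
[r+m∸2m]+[r+m∸2m]+r⊓[2m∸r]≡r r m r≤2m rewrite ℕP.+-identityʳ m with ℕP.≤-total r m
... | inj₁ r≤m = cong₂ (λ e k → e + e + k)
  (ℕP.m≤n⇒m∸n≡0 (ℕP.+-monoˡ-≤ m r≤m))
  (ℕP.m≤n⇒m⊓n≡m (ℕP.m+n≤o⇒m≤o∸n r (ℕP.+-mono-≤ r≤m r≤m)))
... | inj₂ m≤r with ℕP.m≤n⇒∃[o]m+o≡n m≤r
... | t , refl = begin
  (m + t + m ∸ (m + m)) + (m + t + m ∸ (m + m)) + (m + t) ⊓ (m + m ∸ (m + t))
                              ≡⟨ cong₂ (λ e k → e + e + (m + t) ⊓ k) e≡t (ℕP.[m+n]∸[m+o]≡n∸o m m t) ⟩
  t + t + (m + t) ⊓ (m ∸ t)   ≡⟨ cong (λ k → t + t + k) (ℕP.m≥n⇒m⊓n≡n (ℕP.≤-trans (ℕP.m∸n≤m m t) (ℕP.m≤m+n m t))) ⟩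
  t + t + (m ∸ t)             ≡⟨ ℕP.+-assoc t t (m ∸ t) ⟩
  t + (t + (m ∸ t))           ≡⟨ cong (λ k → t + k) (ℕP.m+[n∸m]≡n (ℕP.+-cancelˡ-≤ m t m r≤2m)) ⟩
  t + m                       ≡⟨ ℕP.+-comm t m ⟩
  m + t                       ∎
  where
  open ≡-Reasoning
  e≡t : m + t + m ∸ (m + m) ≡ t
  e≡t = trans (cong (_∸ (m + m)) (ℕP.+-assoc m t m)) (trans (ℕP.[m+n]∸[m+o]≡n∸o m (t + m) m) (ℕP.m+n∸n≡m t m))

module _ (m : ℕ) .{{_ : NonZero m}} where
  private instance
    2m≢0 : NonZero (2 * m)
    2m≢0 = 2*m≢0 m

  m*[z/2m]≡z/2 : ∀ z → (+ m / 1) ℚ.* (+ z / (2 * m)) ≡ + z / 2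
  m*[z/2m]≡z/2 z = trans (*-/ m 1 z (2 * m))
    ((/-cross (m * z) (1 * (2 * m)) z 2 {{ℕP.m*n≢0 1 (2 * m)}})
      (solve 2 (λ m z → m :* z :* con 2 := z :* (con 1 :* (con 2 :* m))) refl m z))

  a≡n/2-m*[z/2m] : ∀ a z n → a + a + z ≡ n → + a / 1 ≡ + n / 2 - (+ m / 1) ℚ.* (+ z / (2 * m))
  a≡n/2-m*[z/2m] a z n a+a+z≡n = begin
    + a / 1                                      ≡⟨ //-rightDividesʳ (+ z / 2) (+ a / 1) ⟨
    (+ a / 1) ℚ.+ (+ z / 2) - + z / 2            ≡⟨ cong (_- + z / 2) a+z/2≡n/2 ⟩
    + n / 2 - + z / 2                            ≡⟨ cong (λ w → + n / 2 - w) (m*[z/2m]≡z/2 z) ⟨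
    + n / 2 - (+ m / 1) ℚ.* (+ z / (2 * m))      ∎
    where
    open ≡-Reasoning
    a+z/2≡n/2 : (+ a / 1) ℚ.+ (+ z / 2) ≡ + n / 2
    a+z/2≡n/2 = trans (+-/ a 1 z 2) (/-cross (a * 2 + z * 1) (1 * 2) n 2
      (trans (solve 2 (λ a z → (a :* con 2 :+ z :* con 1) :* con 2 := (a :+ a :+ z) :* (con 1 :* con 2)) refl a z)
             (cong (_* (1 * 2)) a+a+z≡n)))

corollary2p3 : (n m : ℕ) → .{{_ : NonZero m}} →
    (∑< m (λ i → floor (_/_ (+ (n + i)) (2 * m) {{2*m≢0 m}})) / 1)
    ≡ (+ n / 2) - ((+ m / 1) ℚ.* Zigzag (_/_ (+ n) (2 * m) {{2*m≢0 m}}))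
corollary2p3 n m = begin
  ∑< m (λ i → floor (+ (n + i) / (2 * m))) / 1     ≡⟨ cong (_/ 1) ∑≡mq+e ⟩
  + (m * q + e) / 1                                ≡⟨ a≡n/2-m*[z/2m] m (m * q + e) z n 2[mq+e]+z≡n ⟩
  + n / 2 - (+ m / 1) ℚ.* (+ z / (2 * m))          ≡⟨ cong (λ w → + n / 2 - (+ m / 1) ℚ.* w) (Zigzag-/ n (2 * m)) ⟨
  + n / 2 - (+ m / 1) ℚ.* Zigzag (+ n / (2 * m))   ∎
  where
  open ≡-Reasoning
  instance
    2m≢0 : NonZero (2 * m)
    2m≢0 = 2*m≢0 m
  q = n ℕ./ (2 * m)
  r = n % (2 * m)
  e = r + m ∸ 2 * m
  z = r ⊓ (2 * m ∸ r)
  ∑≡mq+e : ∑< m (λ i → floor (+ (n + i) / (2 * m))) ≡ + (m * q + e)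
  ∑≡mq+e = trans (∑<-cong m (λ i → floor-/ (n + i) (2 * m))) (∑<[n+i]/d n (2 * m) m (ℕP.m≤m+n m (m + 0)))
  2[mq+e]+z≡n : m * q + e + (m * q + e) + z ≡ n
  2[mq+e]+z≡n = begin
    m * q + e + (m * q + e) + z   ≡⟨ solve 4 (λ m q e z → m :* q :+ e :+ (m :* q :+ e) :+ z := q :* (con 2 :* m) :+ (e :+ e :+ z)) refl m q e z ⟩
    q * (2 * m) + (e + e + z)     ≡⟨ cong (λ k → q * (2 * m) + k) ([r+m∸2m]+[r+m∸2m]+r⊓[2m∸r]≡r r m (ℕP.<⇒≤ (m%n<n n (2 * m)))) ⟩
    q * (2 * m) + r               ≡⟨ ℕP.+-comm (q * (2 * m)) r ⟩
    r + q * (2 * m)               ≡⟨ m≡m%n+[m/n]*n n (2 * m) ⟨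
    n                             ∎
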